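{- Let $\mathcal{P}$ be a finite chiral $n$-polytope such that $X(\mathcal{P})$ is simple, and let $\mathcal{Q}$ be a finite directly regular $n$-polytope. If $|X(\mathcal{P})|$ does not divide $|\Gamma^+(\mathcal{Q})|$, then $\mathcal{P}\diamond\mathcal{Q}$ is chiral and $X(\mathcal{P}\diamond\mathcal{Q})=X(\mathcal{P})$ (in particular $X(\mathcal{P}\diamond\mathcal{Q})\cong X(\mathcal{P})$).
   Context: All polytopes are abstract polytopes. A regular polytope is directly regular if its rotation group $\Gamma^+(\mathcal{P})$, generated by $\sigma_i=\rho_{i-1}\rho_i$ ($\rho_0,\dots,\rho_{n-1}$ the standard generating involutions relative to a base flag), has index $2$ in the automorphism group. A polytope is chiral if its automorphism group has two orbits on flags, adjacent flags lying in distinct orbits; then $\Gamma^+(\mathcal{P})$ is the full automorphism group, generated by standard rotations $\sigma_1,\dots,\sigma_{n-1}$. Let $W^+=\langle \sigma_1,\dots,\sigma_{n-1}\mid (\sigma_i\cdots\sigma_j)^2=1,\ 1\le i<j\le n-1\rangle$; each such $\Gamma^+(\mathcal{P})$ equals $W^+/M$ for a normal subgroup $M$, generators corresponding. Let $w\mapsto\overline{w}$ be the automorphism of $W^+$ with $\sigma_1\mapsto\sigma_1^{ -1}$, $\sigma_2\mapsto\sigma_1^2\sigma_2$, $\sigma_j\mapsto\sigma_j$ ($j\ge3$). Mix: if $\Gamma^+(\mathcal{P})=W^+/M$ and $\Gamma^+(\mathcal{Q})=W^+/K$, the mix $\mathcal{P}\diamond\mathcal{Q}$ is the (flag-connected pre-)polytope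 whose rotation group is the subgroup of $\Gamma^+(\mathcal{P})\times\Gamma^+(\mathcal{Q})$ generated by $(\sigma_i,\sigma_i')$, isomorphic to $W^+/N$ with $N=M\cap K$; it is chiral if $\overline N\ne N$ and directly regular otherwise. Chirality group: for rotation group $W^+/N$, $X=N\overline{N}/N$, the kernel of the natural epimorphism $W^+/N\to W^+/(N\overline N)$. -}

module Defs where

open import Data.Nat using (ℕ; zero; suc; _≤_; _<_; _∸_)
open import Data.Nat.Properties using (_≤?_; _<?_)
open import Data.Fin using (Fin; zero; suc; toℕ)
open import Data.Fin.Subset using (Subset; _∈_; _∩_)
open import Data.Bool using (Bool; true; false; not)
open import Data.List using (List; []; _∷_; _++_; map; reverse; filter; concatMap; allFin)
open import Data.List.Relation.Unary.All using (All)
open import Data.Product using (Σ; ∃; _×_; _,_; proj₁; proj₂; uncurry)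
open import Relation.Nullary using (¬_; yes; no)
open import Relation.Nullary.Decidable using (_×-dec_)
open import Relation.Binary.PropositionalEquality using (_≡_)
open import Data.Unit using (⊤)

-- Words in the generators σ₁ … σₘ of W⁺ (m = n - 1 for rank n).
-- A letter (k , true) is σ_{k+1}, a letter (k , false) is σ_{k+1}⁻¹.

Letter : ℕ → Set
Letter m = Fin m × Bool

Word : ℕ → Set
Word m = List (Letter m)

flipL : ∀ {m} → Letter m → Letter m
flipL (k , b) = (k , not b)

inv : ∀ {m} → Word m → Word m
inv w = reverse (map flipL w)

-- A set of words (predicate) is a "normal word set" iff it is the full
-- preimage in the free monoid on letters of a normal subgroup of the free
-- group F(σ₁,…,σₘ).  Normal subgroups of W⁺ = F / R are exactly such sets
-- containing the relators R (see `ContainsRelators`).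
record IsNormalWordSet {m} (M : Word m → Set) : Set where
  field
    empty  : M []
    cancel : ∀ x → M (x ∷ flipL x ∷ [])
    ins    : ∀ a b u → M u → M (a ++ b) → M (a ++ u ++ b)
    del    : ∀ a b u → M u → M (a ++ u ++ b) → M (a ++ b)

-- seg a b = σ_{a+1} σ_{a+2} ⋯ σ_b  (generators with index k, a ≤ k < b)
seg : ∀ {m} → ℕ → ℕ → Word m
seg {m} a b =
  map (λ k → (k , true))
      (filter (λ k → (a ≤? toℕ k) ×-dec (toℕ k <? b)) (allFin m))

-- The defining relators of W⁺ : (σᵢ ⋯ σⱼ)² for 1 ≤ i < j ≤ m
-- (i = a + 1, j = b).
ContainsRelators : ∀ {m} → (Word m → Set) → Set
ContainsRelators {m} M =
  ∀ a b → suc a < b → b ≤ m → M (seg a b ++ seg a b)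

_≐_ : ∀ {m} → (Word m → Set) → (Word m → Set) → Set
A ≐ B = (∀ w → A w → B w) × (∀ w → B w → A w)

_⊆w_ : ∀ {m} → (Word m → Set) → (Word m → Set) → Set
A ⊆w B = ∀ w → A w → B w

_∩w_ : ∀ {m} → (Word m → Set) → (Word m → Set) → (Word m → Set)
(A ∩w B) w = A w × B w

-- The automorphism w ↦ w̄ of W⁺ :
--   σ₁ ↦ σ₁⁻¹ ,  σ₂ ↦ σ₁² σ₂ ,  σⱼ ↦ σⱼ (j ≥ 3).

barL : ∀ {m} → Letter m → Word m
barL (zero , b) = (zero , not b) ∷ []
barL (suc zero , true) = (zero , true) ∷ (zero , true) ∷ (suc zero , true) ∷ []
barL (suc zero , false) = (suc zero , false) ∷ (zero , false) ∷ (zero , false) ∷ []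
barL (suc (suc k) , b) = (suc (suc k) , b) ∷ []

bar : ∀ {m} → Word m → Word m
bar w = concatMap barL w

-- N̄ = image of N under the (involutory) automorphism; as a set of words
-- this is the preimage { w ∣ w̄ ∈ N }.
Bar : ∀ {m} → (Word m → Set) → (Word m → Set)
Bar N w = N (bar w)

-- Product A B of (normal) subgroups: w = u · (u⁻¹ w) with u ∈ A, u⁻¹w ∈ B
Prod : ∀ {m} → (Word m → Set) → (Word m → Set) → (Word m → Set)
Prod A B w = ∃ λ u → A u × B (inv u ++ w)

-- Preimage in W⁺ of the chirality group X = N N̄ / N
XPre : ∀ {m} → (Word m → Set) → (Word m → Set)
XPre N = Prod N (Bar N)

-- Orders of finite (sub)quotients.
-- `QuotOrder S M k` : S is a union of M-cosets and the group S/M ≤ W⁺/M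
-- has exactly k elements (k pairwise M-inequivalent representatives in S
-- such that every element of S is M-equivalent to one of them).
-- Here u and v are M-equivalent iff u v⁻¹ ∈ M.

QuotOrder : ∀ {m} → (Word m → Set) → (Word m → Set) → ℕ → Set
QuotOrder {m} S M k =
  Σ (Fin k → Word m) λ f →
    (∀ i → S (f i)) ×
    (∀ i j → M (f i ++ inv (f j)) → i ≡ j) ×
    (∀ w → S w → ∃ λ i → M (w ++ inv (f i)))

AllWords : ∀ {m} → Word m → Set
AllWords _ = ⊤

-- Intersection condition for the rotation group W⁺/M of rank n:
-- ρ-indices are Fin n, generator indices Fin (n ∸ 1).
-- τ_{i,j} = ρᵢρⱼ = σ_{i+1} ⋯ σⱼ for i < j, τ_{i,j} = τ_{j,i}⁻¹, τ_{i,i} = 1.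

tau : ∀ {n} → Fin n → Fin n → Word (n ∸ 1)
tau i j with toℕ i ≤? toℕ j
... | yes _ = seg (toℕ i) (toℕ j)
... | no _  = inv (seg (toℕ j) (toℕ i))

-- w (mod M) lies in Γ_I = ⟨ τ_{i,j} ∣ i , j ∈ I ⟩
InΓ : ∀ {n} → (Word (n ∸ 1) → Set) → Subset n → Word (n ∸ 1) → Set
InΓ {n} M I w =
  ∃ λ (u : List (Fin n × Fin n)) →
    All (λ p → (proj₁ p ∈ I) × (proj₂ p ∈ I)) u ×
    M (concatMap (uncurry (tau {n})) u ++ inv w)

IntersectionCondition : ∀ {n} → (Word (n ∸ 1) → Set) → Set
IntersectionCondition {n} M =
  ∀ (I J : Subset n) w → InΓ M I w → InΓ M J w → InΓ M (I ∩ J) w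

-- W⁺/M is the rotation group of an n-polytope that is chiral or directly
-- regular (Schulte–Weiss characterisation)
record IsRotGroup (n : ℕ) (M : Word (n ∸ 1) → Set) : Set where
  field
    normal    : IsNormalWordSet M
    relators  : ContainsRelators M
    intersect : IntersectionCondition {n} M

IsChiral : ∀ {m} → (Word m → Set) → Set
IsChiral N = ¬ (Bar N ≐ N)

IsDirectlyRegular : ∀ {m} → (Word m → Set) → Set
IsDirectlyRegular N = Bar N ≐ N

-- A normal subgroup of X corresponds to a set L with N ⊆ L ⊆ N N̄ which is
-- a union of N-cosets, closed under products and inverses, and closed under
-- conjugation by elements of N N̄.

record IsNormalInX {m} (N : Word m → Set) (L : Word m → Set) : Set where
  field
    base    : N ⊆w L
    inX     : L ⊆w XPre N
    coset   : ∀ u v → N (u ++ inv v) → L u → L v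
    product : ∀ u v → L u → L v → L (u ++ v)
    inverse : ∀ u → L u → L (inv u)
    conj    : ∀ g u → XPre N g → L u → L (g ++ u ++ inv g)

record XSimple {m} (N : Word m → Set) : Set₁ where
  field
    nontrivial : ∃ λ w → XPre N w × ¬ N w
    simple     : ∀ (L : Word m → Set) → IsNormalInX N L →
                 (∃ λ w → L w × ¬ N w) → XPre N ⊆w L

{-# OPTIONS --safe #-}
module Submission where

-- Write N = M ∩ K. Since N̄ ⊆ K̄ = K, an element of N N̄ lying in M lies in N, so the natural
-- map X(P ◇ Q) = N N̄/N → X(P) = M M̄/M is injective, and its image is normal in X(P).
-- If some v ∈ M̄ ∩ K lies outside M, then v ∈ N̄ ∖ M, so the image is nontrivial and hence,
-- X(P) being simple, all of X(P); in particular N̄ ≠ N. Otherwise M̄ ∩ K ⊆ M, so y ↦ yM is a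
-- well-defined map from M̄K/K onto X(P) whose fibres are right translates of one another;
-- thus |X(P)| divides |M̄K/K|, which divides |W⁺/K| by Lagrange, a contradiction.
-- The case split is decidable: the predicates involved depend only on the classes of w
-- modulo M and K and of w̄ modulo M, and a finite set of words meeting all these classes is
-- found by saturating under left multiplication by letters.

open import Defs
open import Data.Nat using (ℕ; zero; suc; _+_; _*_; _∸_)
open import Data.Nat.Divisibility using (_∣_; divides; ∣-trans; m∣m*n)
open import Data.Nat.Properties using (+-*-semiring; +-identityʳ; *-identityʳ)
open import Data.Fin using (Fin; zero; suc; combine) renaming (_<_ to _<ᶠ_)
open import Data.Fin.Properties using (_≟_; combine-injective; <-cmp)
import Data.Fin.Properties as Fin
open import Data.Fin.Subset using (Subset; ⁅_⁆; _∪_; _⊃_) renaming (_∈_ to _∈ₛ_; _∉_ to _∉ₛ_; ⊥ to ∅)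
open import Data.Fin.Subset.Properties using (_∈?_; ∉⊥; x∈⁅x⁆; x∈⁅y⁆⇒x≡y; x∈p∪q⁺; x∈p∪q⁻; q⊆p∪q)
open import Data.Fin.Subset.Induction using (Acc; acc; ⊃-wellFounded)
open import Data.Fin.Induction using (<-wellFounded)
open import Data.Bool using (Bool; true; false; not; _∧_)
open import Data.Bool.Properties using (not-involutive)
open import Data.List using (List; []; _∷_; _++_; map; reverse; concatMap; foldr; allFin; cartesianProduct)
open import Data.List.Properties
  using (++-assoc; ++-identityʳ; reverse-++; map-++; reverse-involutive; reverse-map; unfold-reverse; concatMap-++; ++-monoid)
open import Data.List.Membership.Propositional using (_∈_; find; lose)
open import Data.List.Membership.Propositional.Properties using (∈-allFin; ∈-cartesianProduct⁺)
open import Data.List.Relation.Unary.Any using (Any; here; there; any?)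
open import Data.List.Relation.Unary.All using (All; all?) renaming (lookup to All-lookup)
open import Data.List.Relation.Unary.All.Properties using (¬All⇒Any¬)
open import Data.Product using (∃; _×_; _,_; proj₁; proj₂; map₂)
open import Data.Sum using (_⊎_; inj₁; inj₂; fromInj₂)
open import Data.Unit using (tt)
open import Function using (_∘_)
open import Relation.Unary using (Decidable)
open import Relation.Nullary using (¬_; Dec; yes; no; does; contradiction)
open import Relation.Nullary.Decidable using (_×-dec_; ¬?; map′; decidable-stable)
open import Relation.Binary.Definitions using (tri<; tri≈; tri>)
open import Relation.Binary.PropositionalEquality
open import Tactic.MonoidSolver using (solve)
open import Algebra.Properties.Semiring.Sum +-*-semiring
  using (sum; sum-cong-≗; ∑-comm; sum-permute; *-distribˡ-sum; *-distribʳ-sum)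
open import Data.Fin.Permutation using (permutation)

module _ {m : ℕ} where

  flipL-involutive : (l : Letter m) → flipL (flipL l) ≡ l
  flipL-involutive (k , b) = cong (k ,_) (not-involutive b)

  map-flipL-involutive : (u : Word m) → map flipL (map flipL u) ≡ u
  map-flipL-involutive [] = refl
  map-flipL-involutive (l ∷ u) = cong₂ _∷_ (flipL-involutive l) (map-flipL-involutive u)

  inv-++ : (u v : Word m) → inv (u ++ v) ≡ inv v ++ inv u
  inv-++ u v = trans (cong reverse (map-++ flipL u v)) (reverse-++ (map flipL u) (map flipL v))

  inv-involutive : (u : Word m) → inv (inv u) ≡ u
  inv-involutive u = trans (cong reverse (reverse-map flipL (map flipL u)))
                       (trans (reverse-involutive _) (map-flipL-involutive u))

  inv-++₃ : (a b c : Word m) → inv (a ++ b ++ c) ≡ inv c ++ inv b ++ inv a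
  inv-++₃ a b c = trans (inv-++ a (b ++ c)) (trans (cong (_++ inv a) (inv-++ b c)) (++-assoc (inv c) (inv b) (inv a)))

  inv-++-inv : (u v : Word m) → inv (u ++ inv v) ≡ v ++ inv u
  inv-++-inv u v = trans (inv-++ u (inv v)) (cong (_++ inv u) (inv-involutive v))

  inv-∷ : (l : Letter m) (u : Word m) → inv (l ∷ u) ≡ inv u ++ flipL l ∷ []
  inv-∷ l u = unfold-reverse (flipL l) (map flipL u)

module NormalWordSet {m : ℕ} {M : Word m → Set} (nM : IsNormalWordSet M) where
  open IsNormalWordSet nM

  ++-closed : ∀ u v → M u → M v → M (u ++ v)
  ++-closed u v = ins [] v u

  private
    cancelling-pair : (l : Letter m) (u a b : Word m) →
      a ++ (l ∷ u) ++ inv (l ∷ u) ++ b ≡ (a ++ l ∷ []) ++ u ++ inv u ++ flipL l ∷ b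
    cancelling-pair l u a b =
      trans (cong (λ z → a ++ l ∷ u ++ z ++ b) (inv-∷ l u))
        (trans (cong (λ z → a ++ l ∷ u ++ z) (++-assoc (inv u) (flipL l ∷ []) b))
          (sym (++-assoc a (l ∷ []) (u ++ inv u ++ flipL l ∷ b))))

  insert-u∙u⁻¹ : ∀ u a b → M (a ++ b) → M (a ++ u ++ inv u ++ b)
  insert-u∙u⁻¹ [] a b h = h
  insert-u∙u⁻¹ (l ∷ u) a b h = subst M (sym (cancelling-pair l u a b))
    (insert-u∙u⁻¹ u (a ++ l ∷ []) (flipL l ∷ b)
      (subst M (sym (++-assoc a (l ∷ []) (flipL l ∷ b))) (ins a b (l ∷ flipL l ∷ []) (cancel l) h)))

  delete-u∙u⁻¹ : ∀ u a b → M (a ++ u ++ inv u ++ b) → M (a ++ b)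
  delete-u∙u⁻¹ [] a b h = h
  delete-u∙u⁻¹ (l ∷ u) a b h = del a b (l ∷ flipL l ∷ []) (cancel l)
    (subst M (++-assoc a (l ∷ []) (flipL l ∷ b))
      (delete-u∙u⁻¹ u (a ++ l ∷ []) (flipL l ∷ b) (subst M (cancelling-pair l u a b) h)))

  u∙u⁻¹∈ : ∀ u → M (u ++ inv u)
  u∙u⁻¹∈ u = subst M (cong (u ++_) (++-identityʳ (inv u))) (insert-u∙u⁻¹ u [] [] empty)

  u⁻¹∙u∈ : ∀ u → M (inv u ++ u)
  u⁻¹∙u∈ u = subst M (cong (inv u ++_) (inv-involutive u)) (u∙u⁻¹∈ (inv u))

  inv-closed : ∀ u → M u → M (inv u)
  inv-closed u h = subst M (++-identityʳ (inv u))
    (del (inv u) [] u h (subst M (cong (inv u ++_) (sym (++-identityʳ u))) (u⁻¹∙u∈ u)))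

  conj-closed : ∀ g u → M u → M (g ++ u ++ inv g)
  conj-closed g u h = ins g (inv g) u h (u∙u⁻¹∈ g)

  rotate : ∀ a b → M (a ++ b) → M (b ++ a)
  rotate a b h = subst M (++-identityʳ (b ++ a))
    (delete-u∙u⁻¹ b (b ++ a) [] (subst M eq (conj-closed b (a ++ b) h)))
    where
    eq : b ++ (a ++ b) ++ inv b ≡ (b ++ a) ++ b ++ inv b ++ []
    eq = solve (++-monoid (Letter m))

  -- A record rather than M (u ++ inv v) itself, so that u and v can be inferred.
  infix 4 _~_
  record _~_ (u v : Word m) : Set where
    constructor ~⟨_⟩
    field u∙v⁻¹∈ : M (u ++ inv v)
  open _~_ public

  ~-refl : ∀ u → u ~ u
  ~-refl u = ~⟨ u∙u⁻¹∈ u ⟩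

  ~-sym : ∀ {u v} → u ~ v → v ~ u
  ~-sym {u} {v} ~⟨ h ⟩ =
    ~⟨ subst M (inv-++-inv u v) (inv-closed _ h) ⟩

  ~-trans : ∀ {u v w} → u ~ v → v ~ w → u ~ w
  ~-trans {u} {v} {w} ~⟨ h₁ ⟩ ~⟨ h₂ ⟩ = ~⟨ delete-u∙u⁻¹ (inv v) u (inv w)
    (subst M (cong (λ z → u ++ inv v ++ z ++ inv w) (sym (inv-involutive v)))
      (subst M (++-assoc u (inv v) (v ++ inv w)) (++-closed _ _ h₁ h₂))) ⟩

  ∈⇒~[] : ∀ {u} → M u → u ~ []
  ∈⇒~[] {u} h = ~⟨ subst M (sym (++-identityʳ u)) h ⟩

  ~[]⇒∈ : ∀ {u} → u ~ [] → M u
  ~[]⇒∈ {u} ~⟨ h ⟩ = subst M (++-identityʳ u) h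

  ~-resp-∈ : ∀ {u v} → u ~ v → M u → M v
  ~-resp-∈ h mu = ~[]⇒∈ (~-trans (~-sym h) (∈⇒~[] mu))

  ~-congˡ : ∀ a {u v} → u ~ v → a ++ u ~ a ++ v
  ~-congˡ a {u} {v} ~⟨ h ⟩ = ~⟨ subst M eq (conj-closed a (u ++ inv v) h) ⟩
    where
    eq : a ++ (u ++ inv v) ++ inv a ≡ (a ++ u) ++ inv (a ++ v)
    eq = begin
      a ++ (u ++ inv v) ++ inv a ≡⟨ solve (++-monoid (Letter m)) ⟩
      (a ++ u) ++ inv v ++ inv a ≡⟨ cong ((a ++ u) ++_) (sym (inv-++ a v)) ⟩
      (a ++ u) ++ inv (a ++ v)   ∎
      where open ≡-Reasoning

  ~-congʳ : ∀ b {u v} → u ~ v → u ++ b ~ v ++ b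
  ~-congʳ b {u} {v} ~⟨ h ⟩ = ~⟨ subst M eq (insert-u∙u⁻¹ b u (inv v) h) ⟩
    where
    eq : u ++ b ++ inv b ++ inv v ≡ (u ++ b) ++ inv (v ++ b)
    eq = trans (cong (λ z → u ++ b ++ z) (sym (inv-++ v b))) (sym (++-assoc u b _))

  ~-cong : ∀ {u u′ v v′} → u ~ u′ → v ~ v′ → u ++ v ~ u′ ++ v′
  ~-cong {u′ = u′} {v} h₁ h₂ = ~-trans (~-congʳ v h₁) (~-congˡ u′ h₂)

  ~-inv : ∀ {u v} → u ~ v → inv u ~ inv v
  ~-inv {u} {v} h =
    ~⟨ subst M (cong (inv u ++_) (sym (inv-involutive v))) (rotate v (inv u) (u∙v⁻¹∈ (~-sym h))) ⟩

  u∙v∙v⁻¹~u : ∀ u v → (u ++ v) ++ inv v ~ u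
  u∙v∙v⁻¹~u u v = ~⟨ subst M eq (insert-u∙u⁻¹ v u (inv u) (u∙u⁻¹∈ u)) ⟩
    where
    eq : u ++ v ++ inv v ++ inv u ≡ ((u ++ v) ++ inv v) ++ inv u
    eq = solve (++-monoid (Letter m))

  u∙u⁻¹∙v~v : ∀ u v → u ++ inv u ++ v ~ v
  u∙u⁻¹∙v~v u v = ~⟨ subst M eq (insert-u∙u⁻¹ u [] (v ++ inv v) (u∙u⁻¹∈ v)) ⟩
    where
    eq : u ++ inv u ++ v ++ inv v ≡ (u ++ inv u ++ v) ++ inv v
    eq = solve (++-monoid (Letter m))

  u⁻¹∙u∙v~v : ∀ u v → inv u ++ u ++ v ~ v
  u⁻¹∙u∙v~v u v = subst (λ z → inv u ++ z ++ v ~ v) (inv-involutive u) (u∙u⁻¹∙v~v (inv u) v)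

module _ {m : ℕ} where

  ∩-normal : {M K : Word m → Set} → IsNormalWordSet M → IsNormalWordSet K → IsNormalWordSet (M ∩w K)
  ∩-normal nM nK = record
    { empty  = M.empty , K.empty
    ; cancel = λ x → M.cancel x , K.cancel x
    ; ins    = λ a b u (mu , ku) (m′ , k′) → M.ins a b u mu m′ , K.ins a b u ku k′
    ; del    = λ a b u (mu , ku) (m′ , k′) → M.del a b u mu m′ , K.del a b u ku k′
    }
    where
    module M = IsNormalWordSet nM
    module K = IsNormalWordSet nK

  bar-++ : (u v : Word m) → bar (u ++ v) ≡ bar u ++ bar v
  bar-++ = concatMap-++ barL

  barL-flipL : (l : Letter m) → barL (flipL l) ≡ inv (barL l)
  barL-flipL (zero , b) = refl
  barL-flipL (suc zero , true) = refl
  barL-flipL (suc zero , false) = refl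
  barL-flipL (suc (suc k) , b) = refl

  Bar-normal : {N : Word m → Set} → IsNormalWordSet N → IsNormalWordSet (Bar N)
  Bar-normal {N} nN = record
    { empty  = N.empty
    ; cancel = λ x → subst N (sym (bar-cancel x)) (NormalWordSet.u∙u⁻¹∈ nN (barL x))
    ; ins    = λ a b u hu h → subst N (sym (bar-++₃ a u b)) (N.ins (bar a) (bar b) (bar u) hu (subst N (bar-++ a b) h))
    ; del    = λ a b u hu h → subst N (sym (bar-++ a b)) (N.del (bar a) (bar b) (bar u) hu (subst N (bar-++₃ a u b) h))
    }
    where
    module N = IsNormalWordSet nN
    bar-cancel : (x : Letter m) → bar (x ∷ flipL x ∷ []) ≡ barL x ++ inv (barL x)
    bar-cancel x = cong (barL x ++_) (trans (++-identityʳ _) (barL-flipL x))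
    bar-++₃ : (a u b : Word m) → bar (a ++ u ++ b) ≡ bar a ++ bar u ++ bar b
    bar-++₃ a u b = trans (bar-++ a (u ++ b)) (cong (bar a ++_) (bar-++ u b))

module Product {m : ℕ} {A B : Word m → Set} (nA : IsNormalWordSet A) (nB : IsNormalWordSet B) where
  private
    module A = NormalWordSet nA
    module B = NormalWordSet nB

  []∈AB : Prod A B []
  []∈AB = [] , IsNormalWordSet.empty nA , IsNormalWordSet.empty nB

  B⊆AB : B ⊆w Prod A B
  B⊆AB w h = [] , IsNormalWordSet.empty nA , h

  AB⊆A : B ⊆w A → Prod A B ⊆w A
  AB⊆A B⊆A w (u , a , b) = A.delete-u∙u⁻¹ u [] w (A.++-closed u (inv u ++ w) a (B⊆A (inv u ++ w) b))

  AB-++-closed : ∀ w₁ w₂ → Prod A B w₁ → Prod A B w₂ → Prod A B (w₁ ++ w₂)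
  AB-++-closed w₁ w₂ (u₁ , a₁ , b₁) (u₂ , a₂ , b₂) = u₁ ++ u₂ , A.++-closed u₁ u₂ a₁ a₂ ,
    subst B (trans e₁ (cong (_++ w₁ ++ w₂) (sym (inv-++ u₁ u₂))))
      (B.delete-u∙u⁻¹ u₂ (inv u₂ ++ inv u₁ ++ w₁) w₂
        (subst B e₂ (B.++-closed _ _ (subst B (cong (λ z → inv u₂ ++ (inv u₁ ++ w₁) ++ z) (inv-involutive u₂))
                                               (B.conj-closed (inv u₂) (inv u₁ ++ w₁) b₁)) b₂)))
    where
    e₁ : (inv u₂ ++ inv u₁ ++ w₁) ++ w₂ ≡ (inv u₂ ++ inv u₁) ++ w₁ ++ w₂
    e₁ = solve (++-monoid (Letter m))
    e₂ : (inv u₂ ++ (inv u₁ ++ w₁) ++ u₂) ++ inv u₂ ++ w₂ ≡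
         (inv u₂ ++ inv u₁ ++ w₁) ++ u₂ ++ inv u₂ ++ w₂
    e₂ = solve (++-monoid (Letter m))

  AB-inv-closed : ∀ w → Prod A B w → Prod A B (inv w)
  AB-inv-closed w (u , a , b) = inv u , A.inv-closed u a ,
    subst B (cong (_++ inv w) (sym (inv-involutive u)))
      (B.rotate (inv w) u (subst B (trans (inv-++ (inv u) w) (cong (inv w ++_) (inv-involutive u))) (B.inv-closed _ b)))

  AB-conj-closed : ∀ g w → Prod A B w → Prod A B (g ++ w ++ inv g)
  AB-conj-closed g w (u , a , b) = g ++ u ++ inv g , A.conj-closed g u a ,
    subst B eq (B.insert-u∙u⁻¹ (inv g) (g ++ inv u) (w ++ inv g) (subst B e₀ (B.conj-closed g (inv u ++ w) b)))
    where
    e₀ : g ++ (inv u ++ w) ++ inv g ≡ (g ++ inv u) ++ w ++ inv g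
    e₀ = solve (++-monoid (Letter m))
    eq : (g ++ inv u) ++ inv g ++ inv (inv g) ++ w ++ inv g ≡ inv (g ++ u ++ inv g) ++ g ++ w ++ inv g
    eq = begin
      (g ++ inv u) ++ inv g ++ inv (inv g) ++ w ++ inv g   ≡⟨ cong (λ z → (g ++ inv u) ++ inv g ++ z ++ w ++ inv g) (inv-involutive g) ⟩
      (g ++ inv u) ++ inv g ++ g ++ w ++ inv g             ≡⟨ solve (++-monoid (Letter m)) ⟩
      (g ++ inv u ++ inv g) ++ g ++ w ++ inv g             ≡⟨ cong (λ z → (z ++ inv u ++ inv g) ++ g ++ w ++ inv g) (sym (inv-involutive g)) ⟩
      (inv (inv g) ++ inv u ++ inv g) ++ g ++ w ++ inv g   ≡⟨ cong (_++ g ++ w ++ inv g) (sym (inv-++₃ g u (inv g))) ⟩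
      inv (g ++ u ++ inv g) ++ g ++ w ++ inv g             ∎
      where open ≡-Reasoning

  AB-resp-~A : ∀ {v w} → Prod A B v → v A.~ w → Prod A B w
  AB-resp-~A {v} {w} (u , a , b) h = w ++ inv v ++ u ,
    subst A (++-assoc w (inv v) u) (A.++-closed _ _ (A.u∙v⁻¹∈ (A.~-sym h)) a) ,
    subst B eq (B.insert-u∙u⁻¹ (inv w) (inv u ++ v) [] (subst B (sym (++-identityʳ _)) b))
    where
    eq : (inv u ++ v) ++ inv w ++ inv (inv w) ++ [] ≡ inv (w ++ inv v ++ u) ++ w
    eq = begin
      (inv u ++ v) ++ inv w ++ inv (inv w) ++ [] ≡⟨ cong (λ z → (inv u ++ v) ++ inv w ++ z ++ []) (inv-involutive w) ⟩
      (inv u ++ v) ++ inv w ++ w ++ []           ≡⟨ solve (++-monoid (Letter m)) ⟩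
      (inv u ++ v ++ inv w) ++ w                 ≡⟨ cong (λ z → (inv u ++ z ++ inv w) ++ w) (sym (inv-involutive v)) ⟩
      (inv u ++ inv (inv v) ++ inv w) ++ w       ≡⟨ cong (_++ w) (sym (inv-++₃ w (inv v) u)) ⟩
      inv (w ++ inv v ++ u) ++ w                 ∎
      where open ≡-Reasoning

𝟙 : Bool → ℕ
𝟙 true  = 1
𝟙 false = 0

𝟙-∧ : ∀ x y → 𝟙 (x ∧ y) ≡ 𝟙 x * 𝟙 y
𝟙-∧ true  y = sym (+-identityʳ (𝟙 y))
𝟙-∧ false y = refl

count : ∀ {n} {P : Fin n → Set} → Decidable P → ℕ
count P? = sum (λ i → 𝟙 (does (P? i)))

sum-const : ∀ n c → sum {n} (λ _ → c) ≡ n * c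
sum-const zero    c = refl
sum-const (suc n) c = cong (c +_) (sum-const n c)

count-cong : ∀ {n} {P Q : Fin n → Set} (P? : Decidable P) (Q? : Decidable Q) →
             (∀ i → P i → Q i) → (∀ i → Q i → P i) → count P? ≡ count Q?
count-cong {P = P} {Q} P? Q? P⇒Q Q⇒P = sum-cong-≗ (λ i → cong 𝟙 (does-cong (P? i) (Q? i)))
  where
  does-cong : ∀ {i} (p : Dec (P i)) (q : Dec (Q i)) → does p ≡ does q
  does-cong (yes p) (yes q) = refl
  does-cong (yes p) (no ¬q) = contradiction (P⇒Q _ p) ¬q
  does-cong (no ¬p) (yes q) = contradiction (Q⇒P _ q) ¬p
  does-cong (no ¬p) (no ¬q) = refl

count-permute : ∀ {n} {P Q : Fin n → Set} (P? : Decidable P) (Q? : Decidable Q) →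
                (π π⁻¹ : Fin n → Fin n) → (∀ i → π (π⁻¹ i) ≡ i) → (∀ i → π⁻¹ (π i) ≡ i) →
                (∀ i → P (π i) → Q i) → (∀ i → Q i → P (π i)) → count P? ≡ count Q?
count-permute P? Q? π π⁻¹ ππ⁻¹ π⁻¹π P∘π⇒Q Q⇒P∘π =
  trans (sum-permute (λ i → 𝟙 (does (P? i))) (permutation π π⁻¹ ππ⁻¹ π⁻¹π))
        (count-cong (P? ∘ π) Q? P∘π⇒Q Q⇒P∘π)

count-none : ∀ {n} {P : Fin n → Set} (P? : Decidable P) → (∀ i → ¬ P i) → count P? ≡ 0
count-none {zero}  P? ¬P = refl
count-none {suc n} P? ¬P with P? zero
... | yes p = contradiction p (¬P zero)
... | no _  = count-none (P? ∘ suc) (¬P ∘ suc)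

count-unique : ∀ {n} {P : Fin n → Set} (P? : Decidable P) {i₀} →
               P i₀ → (∀ i → P i → i ≡ i₀) → count P? ≡ 1
count-unique {suc n} P? {zero} p unique with P? zero
... | yes _  = cong suc (count-none (P? ∘ suc) (λ i p′ → Fin.0≢1+n (sym (unique (suc i) p′))))
... | no ¬p = contradiction p ¬p
count-unique {suc n} P? {suc i₀} p unique with P? zero
... | yes p₀ = contradiction (unique zero p₀) Fin.0≢1+n
... | no _   = count-unique (P? ∘ suc) p (λ i p′ → Fin.suc-injective (unique (suc i) p′))

module _ {n : ℕ} {_≈_ : Fin n → Fin n → Set} (≈? : ∀ a b → Dec (a ≈ b))
         (≈-refl : ∀ a → a ≈ a) (≈-sym : ∀ {a b} → a ≈ b → b ≈ a)
         (≈-trans : ∀ {a b c} → a ≈ b → b ≈ c → a ≈ c) where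

  private
    Leader : Fin n → Set
    Leader a = ¬ ∃ λ j → j <ᶠ a × j ≈ a

    smaller-equivalent? : ∀ a → Dec (∃ λ j → j <ᶠ a × j ≈ a)
    smaller-equivalent? a = Fin.any? (λ j → (j Fin.<? a) ×-dec ≈? j a)

    Leader? : Decidable Leader
    Leader? a = ¬? (smaller-equivalent? a)

    leader-exists : ∀ b → Acc _<ᶠ_ b → ∃ λ a → Leader a × a ≈ b
    leader-exists b (acc rs) with Leader? b
    ... | yes lb = b , lb , ≈-refl b
    ... | no ¬lb with decidable-stable (smaller-equivalent? b) ¬lb
    ...   | j , j<b , j≈b with leader-exists j (rs j<b)
    ...     | a , la , a≈j = a , la , ≈-trans a≈j j≈b

    leader-unique : ∀ {a a′} → Leader a → Leader a′ → a ≈ a′ → a ≡ a′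
    leader-unique {a} {a′} la la′ a≈a′ with <-cmp a a′
    ... | tri< a<a′ _ _ = contradiction (a , a<a′ , a≈a′) la′
    ... | tri≈ _ a≡a′ _ = a≡a′
    ... | tri> _ _ a′<a = contradiction (a′ , a′<a , ≈-sym a≈a′) la

    one-leader-per-class : ∀ b → count (λ a → Leader? a ×-dec ≈? a b) ≡ 1
    one-leader-per-class b with leader-exists b (<-wellFounded b)
    ... | a , la , a≈b = count-unique (λ a → Leader? a ×-dec ≈? a b) (la , a≈b)
                           (λ a′ (la′ , a′≈b) → leader-unique la′ la (≈-trans a′≈b (≈-sym a≈b)))

  class-size-∣ : ∀ {c} → (∀ a → count (≈? a) ≡ c) → c ∣ n
  class-size-∣ {c} class-size = divides (count Leader?) (begin
    n                                           ≡⟨ sym (*-identityʳ n) ⟩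
    n * 1                                       ≡⟨ sym (sum-const n 1) ⟩
    sum {n} (λ _ → 1)                           ≡⟨ sum-cong-≗ (λ b → sym (one-leader-per-class b)) ⟩
    sum (λ b → sum (λ a → 𝟙 (l a ∧ e a b)))     ≡⟨ ∑-comm {n} {n} (λ b a → 𝟙 (l a ∧ e a b)) ⟩
    sum (λ a → sum (λ b → 𝟙 (l a ∧ e a b)))     ≡⟨ sum-cong-≗ (λ a → sum-cong-≗ (λ b → 𝟙-∧ (l a) (e a b))) ⟩
    sum (λ a → sum (λ b → 𝟙 (l a) * 𝟙 (e a b))) ≡⟨ sum-cong-≗ (λ a → sym (*-distribˡ-sum (𝟙 (l a)) (𝟙 ∘ e a))) ⟩
    sum (λ a → 𝟙 (l a) * count (≈? a))          ≡⟨ sum-cong-≗ (λ a → cong (𝟙 (l a) *_) (class-size a)) ⟩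
    sum (λ a → 𝟙 (l a) * c)                     ≡⟨ sym (*-distribʳ-sum c (𝟙 ∘ l)) ⟩
    count Leader? * c                           ∎)
    where
    open ≡-Reasoning
    l : Fin n → Bool
    l a = does (Leader? a)
    e : Fin n → Fin n → Bool
    e a b = does (≈? a b)

sum-uniform-columns : ∀ {p r} (f : Fin p → Fin r → ℕ) {c} → (∀ i → sum (λ b → f b i) ≡ c) →
                      sum (λ b → sum (λ i → f b i)) ≡ r * c
sum-uniform-columns {p} {r} f {c} columns = trans (∑-comm {p} {r} f) (trans (sum-cong-≗ columns) (sum-const r c))

module FiniteQuotient {m : ℕ} {K : Word m → Set} (nK : IsNormalWordSet K) {q : ℕ} (tK : QuotOrder AllWords K q) where
  open NormalWordSet nK

  rep : Fin q → Word m
  rep = proj₁ tK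

  rep-injective : ∀ {a b} → rep a ~ rep b → a ≡ b
  rep-injective h = proj₁ (proj₂ (proj₂ tK)) _ _ (u∙v⁻¹∈ h)

  cl : Word m → Fin q
  cl w = proj₁ (proj₂ (proj₂ (proj₂ tK)) w tt)

  ~rep-cl : ∀ w → w ~ rep (cl w)
  ~rep-cl w = ~⟨ proj₂ (proj₂ (proj₂ (proj₂ tK)) w tt) ⟩

  cl-sound : ∀ {u v} → cl u ≡ cl v → u ~ v
  cl-sound {u} {v} e = ~-trans (~rep-cl u) (subst (λ a → rep a ~ v) (sym e) (~-sym (~rep-cl v)))

  cl-complete : ∀ {u v} → u ~ v → cl u ≡ cl v
  cl-complete {u} {v} h = rep-injective (~-trans (~-sym (~rep-cl u)) (~-trans h (~rep-cl v)))

  cl-congˡ : ∀ a {u v} → cl u ≡ cl v → cl (a ++ u) ≡ cl (a ++ v)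
  cl-congˡ a e = cl-complete (~-congˡ a (cl-sound e))

  _~?_ : ∀ u v → Dec (u ~ v)
  u ~? v = map′ cl-sound cl-complete (cl u ≟ cl v)

  ∈? : Decidable K
  ∈? w = map′ ~[]⇒∈ ∈⇒~[] (w ~? [])

  shift : Word m → Fin q → Fin q
  shift z b = cl (rep b ++ z)

  rep-shift : ∀ z b → rep (shift z b) ~ rep b ++ z
  rep-shift z b = ~-sym (~rep-cl (rep b ++ z))

  shift-inv-shift : ∀ z b → shift (inv z) (shift z b) ≡ b
  shift-inv-shift z b = rep-injective (~-trans (rep-shift (inv z) (shift z b))
    (~-trans (~-congʳ (inv z) (rep-shift z b)) (u∙v∙v⁻¹~u (rep b) z)))

  shift-shift-inv : ∀ z b → shift z (shift (inv z) b) ≡ b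
  shift-shift-inv z b = subst (λ z′ → shift z′ (shift (inv z) b) ≡ b) (inv-involutive z) (shift-inv-shift (inv z) b)

  module _ {S : Word m → Set} (S? : Decidable S) (S-[] : S []) (S-inv : ∀ {u} → S u → S (inv u))
           (S-++ : ∀ {u v} → S u → S v → S (u ++ v)) (S-resp-~ : ∀ {u v} → u ~ v → S u → S v) where

    subgroup-order-∣ : count (S? ∘ rep) ∣ q
    subgroup-order-∣ = class-size-∣ ≈? ≈-refl ≈-sym ≈-trans class-size
      where
      _≈_ : Fin q → Fin q → Set
      a ≈ b = S (rep b ++ inv (rep a))

      ≈? : ∀ a b → Dec (a ≈ b)
      ≈? a b = S? (rep b ++ inv (rep a))

      ≈-refl : ∀ a → a ≈ a
      ≈-refl a = S-resp-~ (~-sym (∈⇒~[] (u∙u⁻¹∈ (rep a)))) S-[]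

      ≈-sym : ∀ {a b} → a ≈ b → b ≈ a
      ≈-sym {a} {b} h = subst S (inv-++-inv (rep b) (rep a)) (S-inv h)

      ≈-trans : ∀ {a b c} → a ≈ b → b ≈ c → a ≈ c
      ≈-trans {a} {b} {c} h₁ h₂ = S-resp-~ cancel (S-++ h₂ h₁)
        where
        cancel : (rep c ++ inv (rep b)) ++ rep b ++ inv (rep a) ~ rep c ++ inv (rep a)
        cancel = subst (_~ rep c ++ inv (rep a)) (sym (++-assoc (rep c) (inv (rep b)) _))
                   (~-congˡ (rep c) (u⁻¹∙u∙v~v (rep b) (inv (rep a))))

      class-size : ∀ a → count (≈? a) ≡ count (S? ∘ rep)
      class-size a = sym (count-permute (S? ∘ rep) (≈? a) (shift (inv (rep a))) (shift (rep a))
        (shift-inv-shift (rep a)) (shift-shift-inv (rep a))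
        (λ b → S-resp-~ (rep-shift (inv (rep a)) b))
        (λ b → S-resp-~ (~-sym (rep-shift (inv (rep a)) b))))

module Transversal {m B : ℕ} (c : Word m → Fin B)
                   (c-congˡ : ∀ l {u v} → c u ≡ c v → c (l ∷ u) ≡ c (l ∷ v)) where

  letters : List (Letter m)
  letters = cartesianProduct (allFin m) (true ∷ false ∷ [])

  ∈-letters : ∀ l → l ∈ letters
  ∈-letters (k , true)  = ∈-cartesianProduct⁺ (∈-allFin k) (here refl)
  ∈-letters (k , false) = ∈-cartesianProduct⁺ (∈-allFin k) (there (here refl))

  classes : List (Word m) → Subset B
  classes = foldr (λ w S → ⁅ c w ⁆ ∪ S) ∅

  ∈-classes⁻ : ∀ {j} Ws → j ∈ₛ classes Ws → ∃ λ w → w ∈ Ws × c w ≡ j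
  ∈-classes⁻ [] j∈∅ = contradiction j∈∅ ∉⊥
  ∈-classes⁻ (w ∷ Ws) j∈ with x∈p∪q⁻ ⁅ c w ⁆ (classes Ws) j∈
  ... | inj₁ j∈⁅cw⁆ = w , here refl , sym (x∈⁅y⁆⇒x≡y (c w) j∈⁅cw⁆)
  ... | inj₂ j∈Ws with ∈-classes⁻ Ws j∈Ws
  ...   | w′ , w′∈ , e = w′ , there w′∈ , e

  Represents : List (Word m) → Set
  Represents Ws = ∀ w → ∃ λ w′ → w′ ∈ Ws × c w ≡ c w′

  Closed : List (Word m) → Set
  Closed Ws = All (λ w → All (λ l → c (l ∷ w) ∈ₛ classes Ws) letters) Ws

  closed? : ∀ Ws → Dec (Closed Ws)
  closed? Ws = all? (λ w → all? (λ l → c (l ∷ w) ∈? classes Ws) letters) Ws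

  closed⇒represents : ∀ {Ws} → [] ∈ Ws → Closed Ws → Represents Ws
  closed⇒represents []∈ closed [] = [] , []∈ , refl
  closed⇒represents {Ws} []∈ closed (l ∷ w) with closed⇒represents []∈ closed w
  ... | w′ , w′∈ , e with ∈-classes⁻ Ws (All-lookup (All-lookup closed w′∈) (∈-letters l))
  ...   | w″ , w″∈ , e′ = w″ , w″∈ , trans (c-congˡ l e) (sym e′)

  private
    extend : ∀ Ws → ¬ Closed Ws → ∃ λ w → c w ∉ₛ classes Ws
    extend Ws ¬closed with find (¬All⇒Any¬ (λ w → all? (λ l → c (l ∷ w) ∈? classes Ws) letters) Ws ¬closed)
    ... | w , _ , ¬all with find (¬All⇒Any¬ (λ l → c (l ∷ w) ∈? classes Ws) letters ¬all)
    ...   | l , _ , ∉ = l ∷ w , ∉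

    grow : ∀ Ws → Acc _⊃_ (classes Ws) → [] ∈ Ws → ∃ Represents
    grow Ws (acc rs) []∈ with closed? Ws
    ... | yes closed = Ws , closed⇒represents []∈ closed
    ... | no ¬closed with extend Ws ¬closed
    ...   | w , cw∉ = grow (w ∷ Ws) (rs bigger) (there []∈)
      where
      bigger : classes (w ∷ Ws) ⊃ classes Ws
      bigger = q⊆p∪q ⁅ c w ⁆ (classes Ws) , c w , x∈p∪q⁺ (inj₁ (x∈⁅x⁆ (c w))) , cw∉

  -- Abstract: unfolding the search during type checking is prohibitively expensive.
  abstract
    transversal : ∃ Represents
    transversal = grow ([] ∷ []) (⊃-wellFounded _) (here refl)

    ∃? : {P : Word m → Set} → Decidable P → (∀ {u v} → c u ≡ c v → P u → P v) → Dec (∃ P)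
    ∃? P? P-resp with transversal
    ... | Ws , represents = map′ (λ p → let (w , _ , pw) = find p in w , pw)
      (λ (w , pw) → let (w′ , w′∈ , e) = represents w in lose w′∈ (P-resp e pw))
      (any? P? Ws)

module ImageInChiralityGroup {m : ℕ} {M K : Word m → Set} (nM : IsNormalWordSet M) (nK : IsNormalWordSet K)
                             (K-regular : IsDirectlyRegular K) where
  private
    N : Word m → Set
    N = M ∩w K
    nN = ∩-normal nM nK
    module M = NormalWordSet nM
    module K = NormalWordSet nK
    module XN = Product nN (Bar-normal nN)
    module XM = Product nM (Bar-normal nM)

  Image : Word m → Set
  Image w = ∃ λ v → XPre N v × v M.~ w

  XPre-∩-mono : XPre N ⊆w XPre M
  XPre-∩-mono w (u , (mu , _) , (bmu , _)) = u , mu , bmu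

  XPre-∩-injective : ∀ w → XPre N w → M w → N w
  XPre-∩-injective w (u , (_ , ku) , (_ , bku)) mw =
    mw , Product.AB⊆A nK (Bar-normal nK) (proj₁ K-regular) w (u , ku , bku)

  Image-normal : IsNormalInX M Image
  Image-normal = record
    { base    = λ w mw → [] , XN.[]∈AB , M.~-sym (M.∈⇒~[] mw)
    ; inX     = λ w (v , xv , v~w) → XM.AB-resp-~A (XPre-∩-mono v xv) v~w
    ; coset   = λ u v u~v (v₁ , xv₁ , v₁~u) → v₁ , xv₁ , M.~-trans v₁~u M.~⟨ u~v ⟩
    ; product = λ u v (v₁ , x₁ , h₁) (v₂ , x₂ , h₂) → v₁ ++ v₂ , XN.AB-++-closed v₁ v₂ x₁ x₂ , M.~-cong h₁ h₂
    ; inverse = λ u (v₁ , x₁ , h₁) → inv v₁ , XN.AB-inv-closed v₁ x₁ , M.~-inv h₁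
    ; conj    = λ g u _ (v₁ , x₁ , h₁) → g ++ v₁ ++ inv g , XN.AB-conj-closed g v₁ x₁ ,
                                         M.~-congˡ g (M.~-congʳ (inv g) h₁)
    }

  Image-nontrivial : (∃ λ v → (Bar M ∩w K) v × ¬ M v) → ∃ λ w → Image w × ¬ M w
  Image-nontrivial (v , (bmv , kv) , ¬mv) =
    v , (v , XN.B⊆AB v (bmv , proj₂ K-regular v kv) , M.~-refl v) , ¬mv

  module _ (X-simple : XSimple M) where

    Image-surjective : (∃ λ v → (Bar M ∩w K) v × ¬ M v) → XPre M ⊆w Image
    Image-surjective v = XSimple.simple X-simple Image Image-normal (Image-nontrivial v)

    ∩-chiral : XPre M ⊆w Image → IsChiral N
    ∩-chiral surjective N-regular with XSimple.nontrivial X-simple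
    ... | w , xw , ¬mw with surjective w xw
    ... | v , xv , v~w = ¬mw (M.~-resp-∈ v~w (proj₁ (Product.AB⊆A nN (Bar-normal nN) (proj₁ N-regular) v xv)))

module CosetCounting {m : ℕ} {M K : Word m → Set} (nM : IsNormalWordSet M) (nK : IsNormalWordSet K)
                     {k q x : ℕ} (tM : QuotOrder AllWords M k) (tK : QuotOrder AllWords K q)
                     (tX : QuotOrder (XPre M) M x) where
  private
    module M = NormalWordSet nM
    module K = NormalWordSet nK
    module M̄ = NormalWordSet (Bar-normal nM)
    module MI = FiniteQuotient nM tM
    module KI = FiniteQuotient nK tK
    module XM = Product nM (Bar-normal nM)
    open M using (~⟨_⟩; u∙v⁻¹∈)

  class : Word m → Fin (k * (q * k))
  class w = combine (MI.cl w) (combine (KI.cl w) (MI.cl (bar w)))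

  class-sound : ∀ {u v} → class u ≡ class v → u M.~ v × u K.~ v × bar u M.~ bar v
  class-sound e with combine-injective _ _ _ _ e
  ... | e₁ , e₂₃ with combine-injective _ _ _ _ e₂₃
  ... | e₂ , e₃ = MI.cl-sound e₁ , KI.cl-sound e₂ , MI.cl-sound e₃

  class-congˡ : ∀ l {u v} → class u ≡ class v → class (l ∷ u) ≡ class (l ∷ v)
  class-congˡ l e with class-sound e
  ... | u~v , u≈v , ū~v̄ = cong₂ combine (MI.cl-congˡ (l ∷ []) (MI.cl-complete u~v))
    (cong₂ combine (KI.cl-congˡ (l ∷ []) (KI.cl-complete u≈v)) (MI.cl-congˡ (barL l) (MI.cl-complete ū~v̄)))

  open Transversal class class-congˡ using (∃?)

  counterexample? : Dec (∃ λ v → (Bar M ∩w K) v × ¬ M v)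
  counterexample? = ∃? (λ v → (MI.∈? (bar v) ×-dec KI.∈? v) ×-dec ¬? (MI.∈? v))
    λ e ((bmu , ku) , ¬mu) → let (u~v , u≈v , ū~v̄) = class-sound e in
      (M.~-resp-∈ ū~v̄ bmu , K.~-resp-∈ u≈v ku) , ¬mu ∘ M.~-resp-∈ (M.~-sym u~v)

  BarM∩K⊆M⊎⊈ : (Bar M ∩w K) ⊆w M ⊎ ∃ λ v → (Bar M ∩w K) v × ¬ M v
  BarM∩K⊆M⊎⊈ = dichotomy counterexample?
    where
    dichotomy : Dec (∃ λ v → (Bar M ∩w K) v × ¬ M v) →
                (Bar M ∩w K) ⊆w M ⊎ ∃ λ v → (Bar M ∩w K) v × ¬ M v
    dichotomy (yes counterexample) = inj₂ counterexample
    dichotomy (no ¬counterexample) =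
      inj₁ λ v bkv → decidable-stable (MI.∈? v) (λ ¬mv → ¬counterexample (v , bkv , ¬mv))

  -- Representatives of the elements of X(P), chosen inside M̄.
  private
    t : Fin x → Word m
    t i = inv (proj₁ (proj₁ (proj₂ tX) i)) ++ proj₁ tX i

    t-bar : ∀ i → Bar M (t i)
    t-bar i = proj₂ (proj₂ (proj₁ (proj₂ tX) i))

    t~rep : ∀ i → t i M.~ proj₁ tX i
    t~rep i = M.~-congʳ (proj₁ tX i) (M.∈⇒~[] (M.inv-closed _ (proj₁ (proj₂ (proj₁ (proj₂ tX) i)))))

    t-injective : ∀ {i j} → t i M.~ t j → i ≡ j
    t-injective {i} {j} ti~tj =
      proj₁ (proj₂ (proj₂ tX)) i j (u∙v⁻¹∈ (M.~-trans (M.~-sym (t~rep i)) (M.~-trans ti~tj (t~rep j))))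

    t-cover : ∀ {y} → XPre M y → ∃ λ i → y M.~ t i
    t-cover {y} xy with proj₂ (proj₂ (proj₂ tX)) y xy
    ... | i , y~i = i , M.~-trans ~⟨ y~i ⟩ (M.~-sym (t~rep i))

  module _ (BarM∩K⊆M : (Bar M ∩w K) ⊆w M) where

    MeetsBar : Word m → Set
    MeetsBar w = ∃ λ y → Bar M y × y K.~ w

    MeetsBar? : Decidable MeetsBar
    MeetsBar? w = ∃? (λ y → MI.∈? (bar y) ×-dec y KI.~? w)
      λ e (by , y≈w) → let (_ , u≈v , ū~v̄) = class-sound e in
        M.~-resp-∈ ū~v̄ by , K.~-trans (K.~-sym u≈v) y≈w

    Fibre : Fin x → Fin q → Set
    Fibre i b = ∃ λ y → Bar M y × y K.~ KI.rep b × y M.~ t i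

    Fibre? : ∀ i → Decidable (Fibre i)
    Fibre? i b = ∃? (λ y → MI.∈? (bar y) ×-dec y KI.~? KI.rep b ×-dec y MI.~? t i)
      λ e (by , y≈b , y~i) → let (u~v , u≈v , ū~v̄) = class-sound e in
        M.~-resp-∈ ū~v̄ by , K.~-trans (K.~-sym u≈v) y≈b , M.~-trans (M.~-sym u~v) y~i

    fibres-partition : ∀ b → count (λ i → Fibre? i b) ≡ 𝟙 (does (MeetsBar? (KI.rep b)))
    fibres-partition b = partition (MeetsBar? (KI.rep b))
      where
      partition : (meets? : Dec (MeetsBar (KI.rep b))) → count (λ i → Fibre? i b) ≡ 𝟙 (does meets?)
      partition (no ¬meets) = count-none (λ i → Fibre? i b) (λ i (y , by , y≈b , _) → ¬meets (y , by , y≈b))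
      partition (yes (y , by , y≈b)) =
        count-unique (λ i → Fibre? i b) (y , by , y≈b , proj₂ (t-cover xy)) unique
        where
        xy : XPre M y
        xy = XM.B⊆AB y by
        unique : ∀ i → Fibre i b → i ≡ proj₁ (t-cover xy)
        unique i (y′ , by′ , y′≈b , y′~i) =
          t-injective (M.~-trans (M.~-sym y′~i) (M.~-trans (M.~-sym y~y′) (proj₂ (t-cover xy))))
          where
          y~y′ : y M.~ y′
          y~y′ = ~⟨ BarM∩K⊆M _ (M̄.++-closed y (inv y′) by (M̄.inv-closed y′ by′) ,
                                K.u∙v⁻¹∈ (K.~-trans y≈b (K.~-sym y′≈b))) ⟩

    fibre-shift : ∀ {i j b} z → Bar M z → t j ++ z M.~ t i → Fibre j b → Fibre i (KI.shift z b)
    fibre-shift {b = b} z bz tj∙z~ti (y , by , y≈b , y~tj) =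
      y ++ z , M̄.++-closed y z by bz ,
      K.~-trans (K.~-congʳ z y≈b) (K.~-sym (KI.rep-shift z b)) , M.~-trans (M.~-congʳ z y~tj) tj∙z~ti

    fibres-equal : ∀ i j → count (Fibre? i) ≡ count (Fibre? j)
    fibres-equal i j = count-permute (Fibre? i) (Fibre? j) (KI.shift z) (KI.shift (inv z))
      (KI.shift-shift-inv z) (KI.shift-inv-shift z)
      (λ b f → subst (Fibre j) (KI.shift-inv-shift z b) (fibre-shift (inv z) (M̄.inv-closed z bz) ti∙z⁻¹~tj f))
      (λ b → fibre-shift z bz (M.u∙u⁻¹∙v~v (t j) (t i)))
      where
      z : Word m
      z = inv (t j) ++ t i
      bz : Bar M z
      bz = M̄.++-closed (inv (t j)) (t i) (M̄.inv-closed (t j) (t-bar j)) (t-bar i)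
      ti∙z⁻¹~tj : t i ++ inv z M.~ t j
      ti∙z⁻¹~tj = subst (λ w → t i ++ w M.~ t j)
        (sym (trans (inv-++ (inv (t j)) (t i)) (cong (inv (t i) ++_) (inv-involutive (t j)))))
        (M.u∙u⁻¹∙v~v (t i) (t j))

    x∣q : x ∣ q
    x∣q = ∣-trans (m∣m*n (count (Fibre? i₀))) (subst (_∣ q) meets-count
      (KI.subgroup-order-∣ MeetsBar? ([] , IsNormalWordSet.empty nM , K.~-refl [])
        (λ (y , by , y≈u) → inv y , M̄.inv-closed y by , K.~-inv y≈u)
        (λ (y₁ , by₁ , h₁) (y₂ , by₂ , h₂) → y₁ ++ y₂ , M̄.++-closed y₁ y₂ by₁ by₂ , K.~-cong h₁ h₂)
        (λ u≈v (y , by , y≈u) → y , by , K.~-trans y≈u u≈v)))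
      where
      i₀ : Fin x
      i₀ = proj₁ (t-cover XM.[]∈AB)
      meets-count : count (MeetsBar? ∘ KI.rep) ≡ x * count (Fibre? i₀)
      meets-count = trans (sum-cong-≗ (λ b → sym (fibres-partition b)))
        (sum-uniform-columns (λ b i → 𝟙 (does (Fibre? i b))) (λ i → fibres-equal i i₀))

theorem4p6 : ∀ (n : ℕ) (M K : Word (n ∸ 1) → Set) →
    -- P : finite chiral n-polytope with rotation group W⁺/M, X(P) simple
    IsRotGroup n M → IsChiral M → (∃ λ k → QuotOrder AllWords M k) →
    XSimple M →
    -- Q : finite directly regular n-polytope with rotation group W⁺/K
    IsRotGroup n K → IsDirectlyRegular K →
    ∀ (x q : ℕ) → QuotOrder (XPre M) M x → QuotOrder AllWords K q →
    ¬ (x ∣ q) →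
    -- P ◇ Q has rotation group W⁺/N with N = M ∩ K
    IsChiral (M ∩w K) ×
    -- the natural map W⁺/N → W⁺/M restricts to a bijection X(P◇Q) → X(P)
    (∀ w → XPre (M ∩w K) w → M w → (M ∩w K) w) ×
    (∀ w → XPre M w → ∃ λ v → XPre (M ∩w K) v × M (v ++ inv w))
theorem4p6 n M K P-rot _ (_ , tM) X-simple Q-rot K-regular x q tX tK x∤q =
  ∩-chiral X-simple surjective , XPre-∩-injective , λ w → map₂ (map₂ u∙v⁻¹∈) ∘ surjective w
  where
  nM = IsRotGroup.normal P-rot
  nK = IsRotGroup.normal Q-rot
  open ImageInChiralityGroup nM nK K-regular
  open CosetCounting nM nK tM tK tX
  open NormalWordSet nM using (u∙v⁻¹∈)

  counterexample : ∃ λ v → (Bar M ∩w K) v × ¬ M v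
  counterexample = fromInj₂ (λ BarM∩K⊆M → contradiction (x∣q BarM∩K⊆M) x∤q) BarM∩K⊆M⊎⊈

  surjective : XPre M ⊆w Image
  surjective = Image-surjective X-simple counterexample
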